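{- Let $K$ be a simplicial complex on $[m]$ and, for each $i\in[m]$, let $K_i$ be a simplicial complex on $[l_i]$. For each $i\in[m]$ and $j\in[l_i]$ let $(X_{ij},A_{ij})$ be a topological pair with $A_{ij}\subseteq X_{ij}$. Put $Y_i=X_{i1}\times\cdots\times X_{il_i}$ and $Z_i=\mathcal{Z}_{K_i}(\underline{(X_{ij},A_{ij})}_{j\in[l_i]})\subseteq Y_i$. Then $$\mathcal{Z}_{K(K_1,\ldots,K_m)}\big(\underline{(X_{ij},A_{ij})}_{i\in[m],\,j\in[l_i]}\big)=\mathcal{Z}_K\big(\underline{(Y_i,Z_i)}_{i\in[m]}\big)$$ as subsets of $\prod_{i,j}X_{ij}=\prod_i Y_i$.
   Context: A simplicial complex on a finite set $V$ is a family of subsets of $V$ closed under taking subsets (ghost vertices, i.e. $v$ with $\{v\}\notin K$, are allowed). For a simplicial complex $K$ on $[m]$ and pairs $(X_i,A_i)$, $A_i\subseteq X_i$, the polyhedral product is $\mathcal{Z}_K(\underline{(X_i,A_i)})=\bigcup_{I\in K}V_I\subseteq\prod_i X_i$, where $V_I=C_1\times\cdots\times C_m$ with $C_i=X_i$ if $i\in I$ and $C_i=A_i$ if $i\notin I$. For $K$ on $[m]$ and $K_i$ on $[l_i]$, the composition $K(K_1,\ldots,K_m)$ is the simplicial complex on $[l_1]\sqcup\cdots\sqcup[l_m]$ in which $I=I_1\sqcup\cdots\sqcup I_m$ ($I_i\subseteq[l_i]$) is a simplex iff $\{i\in[m]\mid I_i\notin K_i\}\in K$. -}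

module Defs where

open import Data.Bool using (Bool; true; false)
open import Data.Nat using (ℕ)
open import Data.Fin using (Fin)
open import Data.Product using (Σ; ∃; _×_; _,_; proj₁; proj₂)
open import Data.Empty using (⊥-elim)
open import Relation.Nullary using (Dec; yes; no; ¬_)
open import Relation.Nullary.Decidable using (does)
open import Relation.Binary.PropositionalEquality using (_≡_; refl)

VSubset : Set → Set
VSubset V = V → Bool

_⊆ᵥ_ : {V : Set} → VSubset V → VSubset V → Set
σ ⊆ᵥ τ = ∀ v → σ v ≡ true → τ v ≡ true

-- Ghost vertices are allowed (no
-- condition on singletons).  Membership is required to be decidable
-- (automatic classically since V is finite in all uses).
record SimplicialComplex (V : Set) : Set₁ where
  field
    face   : VSubset V → Set
    face?  : (σ : VSubset V) → Dec (face σ)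
    closed : ∀ {σ τ} → σ ⊆ᵥ τ → face τ → face σ
open SimplicialComplex public

ZK : {V : Set} → SimplicialComplex V → (X : V → Set) → (A : (v : V) → X v → Set)
   → ((v : V) → X v) → Set
ZK {V} K X A x = Σ (VSubset V) λ I → face K I × (∀ v → I v ≡ false → A v (x v))

block : {m : ℕ} {l : Fin m → ℕ} → VSubset (Σ (Fin m) (λ i → Fin (l i)))
      → (i : Fin m) → VSubset (Fin (l i))
block I i j = I (i , j)

nonFaceSet : {m : ℕ} {l : Fin m → ℕ} → ((i : Fin m) → SimplicialComplex (Fin (l i)))
           → VSubset (Σ (Fin m) (λ i → Fin (l i))) → VSubset (Fin m)
nonFaceSet Ks I i with face? (Ks i) (block I i)
... | yes _ = false
... | no  _ = true

private
  nonFace-mono : {m : ℕ} {l : Fin m → ℕ} (Ks : (i : Fin m) → SimplicialComplex (Fin (l i)))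
    {σ τ : VSubset (Σ (Fin m) (λ i → Fin (l i)))} → σ ⊆ᵥ τ
    → nonFaceSet Ks σ ⊆ᵥ nonFaceSet Ks τ
  nonFace-mono Ks {σ} {τ} s i with face? (Ks i) (block σ i) | face? (Ks i) (block τ i)
  ... | yes _ | _ = λ ()
  ... | no ¬fσ | yes fτ = λ _ → ⊥-elim (¬fσ (closed (Ks i) (λ j → s (i , j)) fτ))
  ... | no _ | no _ = λ _ → refl

compose : {m : ℕ} {l : Fin m → ℕ} → SimplicialComplex (Fin m)
        → ((i : Fin m) → SimplicialComplex (Fin (l i)))
        → SimplicialComplex (Σ (Fin m) (λ i → Fin (l i)))
compose K Ks = record
  { face   = λ I → face K (nonFaceSet Ks I)
  ; face?  = λ I → face? K (nonFaceSet Ks I)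
  ; closed = λ s f → closed K (nonFace-mono Ks s) f
  }

-- A point of the composed polyhedral product with support I is a point of
-- Z_K((Y_i, Z_i)) with support J = {i | I_i ∉ K_i}: off J each block I_i is a
-- face of K_i, which witnesses that the i-th block of the point lies in Z_i.
-- Conversely, given J ∈ K and supports σ_i ∈ K_i for i ∉ J, take the full
-- block on i ∈ J and σ_i off J; its set of non-face blocks lies inside J.
module Submission where

open import Defs
open import Data.Bool using (Bool; true; false)
open import Data.Nat using (ℕ)
open import Data.Fin using (Fin)
open import Data.Product using (Σ; _,_; proj₁; proj₂)
open import Data.Bool.Properties using (not-¬; ¬-not)
open import Function.Bundles using (_⇔_; mk⇔)
open import Relation.Nullary using (yes; no; contradiction)
open import Relation.Binary.PropositionalEquality using (_≡_; refl)

fill : {W : Set} (b : Bool) → (b ≡ false → VSubset W) → VSubset W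
fill true  σ w = true
fill false σ w = σ refl w

fill⊆ : {W : Set} {b : Bool} (σ : b ≡ false → VSubset W) (e : b ≡ false) →
        fill b σ ⊆ᵥ σ e
fill⊆ σ refl w p = p

fill≡false : {W : Set} (b : Bool) (σ : b ≡ false → VSubset W) (w : W) →
             fill b σ w ≡ false → Σ (b ≡ false) λ e → σ e w ≡ false
fill≡false false σ w p = refl , p

module _ {m : ℕ} {l : Fin m → ℕ} (Ks : (i : Fin m) → SimplicialComplex (Fin (l i)))
         (I : VSubset (Σ (Fin m) (λ i → Fin (l i)))) (i : Fin m) where

  nonFaceSet≡false⇒face : nonFaceSet Ks I i ≡ false → face (Ks i) (block I i)
  nonFaceSet≡false⇒face p with face? (Ks i) (block I i)
  ... | yes f = f

  face⇒nonFaceSet≡false : face (Ks i) (block I i) → nonFaceSet Ks I i ≡ false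
  face⇒nonFaceSet≡false f with face? (Ks i) (block I i)
  ... | yes _ = refl
  ... | no ¬f = contradiction f ¬f

module _ {m : ℕ} {l : Fin m → ℕ}
         (K : SimplicialComplex (Fin m))
         (Ks : (i : Fin m) → SimplicialComplex (Fin (l i)))
         (X : (i : Fin m) → Fin (l i) → Set)
         (A : (i : Fin m) → (j : Fin (l i)) → X i j → Set)
         (x : (i : Fin m) → (j : Fin (l i)) → X i j) where

  ZK-compose : Set
  ZK-compose = ZK (compose K Ks) (λ p → X (proj₁ p) (proj₂ p))
                  (λ p → A (proj₁ p) (proj₂ p)) (λ p → x (proj₁ p) (proj₂ p))

  ZK-blocks : Set
  ZK-blocks = ZK K (λ i → (j : Fin (l i)) → X i j) (λ i y → ZK (Ks i) (X i) (A i) y) x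

  ZK-compose⇒ZK-blocks : ZK-compose → ZK-blocks
  ZK-compose⇒ZK-blocks (I , faceI , inA) = nonFaceSet Ks I , faceI , inZ
    where
    inZ : ∀ i → nonFaceSet Ks I i ≡ false → ZK (Ks i) (X i) (A i) (x i)
    inZ i p = block I i , nonFaceSet≡false⇒face Ks I i p , λ j → inA (i , j)

  ZK-blocks⇒ZK-compose : ZK-blocks → ZK-compose
  ZK-blocks⇒ZK-compose (J , faceJ , inZ) = I , closed K nonFaceSet⊆J faceJ , inA
    where
    σ : ∀ i → J i ≡ false → VSubset (Fin (l i))
    σ i e = proj₁ (inZ i e)

    I : VSubset (Σ (Fin m) (λ i → Fin (l i)))
    I (i , j) = fill (J i) (σ i) j

    blockFace : ∀ i → J i ≡ false → face (Ks i) (block I i)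
    blockFace i e = closed (Ks i) (fill⊆ (σ i) e) (proj₁ (proj₂ (inZ i e)))

    nonFaceSet⊆J : nonFaceSet Ks I ⊆ᵥ J
    nonFaceSet⊆J i p = ¬-not λ e → not-¬ p (face⇒nonFaceSet≡false Ks I i (blockFace i e))

    inA : ∀ p → I p ≡ false → A (proj₁ p) (proj₂ p) (x (proj₁ p) (proj₂ p))
    inA (i , j) p with fill≡false (J i) (σ i) j p
    ... | e , q = proj₂ (proj₂ (inZ i e)) j q

mainTheorem5 : (m : ℕ) (l : Fin m → ℕ)
    (K : SimplicialComplex (Fin m))
    (Ks : (i : Fin m) → SimplicialComplex (Fin (l i)))
    (X : (i : Fin m) → Fin (l i) → Set)
    (A : (i : Fin m) → (j : Fin (l i)) → X i j → Set)
    (x : (i : Fin m) → (j : Fin (l i)) → X i j) →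
    ZK (compose K Ks) (λ p → X (proj₁ p) (proj₂ p)) (λ p → A (proj₁ p) (proj₂ p))
       (λ p → x (proj₁ p) (proj₂ p))
    ⇔ ZK K (λ i → (j : Fin (l i)) → X i j) (λ i y → ZK (Ks i) (X i) (A i) y) x
mainTheorem5 m l K Ks X A x =
  mk⇔ (ZK-compose⇒ZK-blocks K Ks X A x) (ZK-blocks⇒ZK-compose K Ks X A x)
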